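{- If $K$ is a nonevasive $2$-complex and one of its vertices has link isomorphic to the single-edge graph, then $K$ has at least one other vertex whose link is a tree.
   Context: A $2$-complex is a finite simplicial complex of dimension at most $2$. For a vertex $v$ of $K$, the link $\mathrm{lk}_K(v)$ is the graph consisting of faces $\tau\in K$ with $v\notin\tau$ and $\tau\cup\{v\}\in K$; $K\setminus v$ is the subcomplex of faces not containing $v$. A complex $K$ is nonevasive if either $K$ is the one-point complex or there is a vertex $v$ such that both $\mathrm{lk}_K(v)$ and $K\setminus v$ are nonevasive. (For graphs, nonevasive means being a tree, so a $2$-complex is nonevasive iff it is the one-point complex or has a vertex whose link is a tree and whose deletion is nonevasive.) -}

module Defs where

open import Data.Nat using (ℕ; _≤_; _<_)
open import Data.Fin using (Fin)
open import Data.Fin.Subset using (Subset; _∈_; _∉_; _⊆_; ⁅_⁆; _∪_; ∣_∣)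
open import Data.List using (List; []; _∷_; _++_; length)
open import Data.List.Relation.Unary.Linked using (Linked)
open import Data.List.Relation.Unary.Unique.Propositional using (Unique)
open import Data.Product using (Σ; ∃; _×_)
open import Relation.Binary.PropositionalEquality using (_≡_; _≢_)
open import Relation.Nullary using (¬_)
open import Level using (suc; zero)

record Complex (n : ℕ) : Set₁ where
  field
    face      : Subset n → Set
    downClosed : ∀ {σ τ} → σ ⊆ τ → face τ → face σ
open Complex public

Dim≤2 : ∀ {n} → Complex n → Set
Dim≤2 K = ∀ σ → face K σ → ∣ σ ∣ ≤ 3

IsVertex : ∀ {n} → Complex n → Fin n → Set
IsVertex K v = face K ⁅ v ⁆

link : ∀ {n} → Complex n → Fin n → Complex n
link K v = record
  { face = λ τ → (v ∉ τ) × face K (τ ∪ ⁅ v ⁆)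
  ; downClosed = λ {σ} {τ} σ⊆τ p → linkDown σ⊆τ p }
  where
  open import Data.Product using (_,_)
  open import Data.Fin.Subset.Properties using (p⊆p∪q; q⊆p∪q; x∈p∪q⁻)
  open import Data.Sum using (inj₁; inj₂)
  linkDown : ∀ {σ τ} → σ ⊆ τ → (v ∉ τ) × face K (τ ∪ ⁅ v ⁆) → (v ∉ σ) × face K (σ ∪ ⁅ v ⁆)
  linkDown {σ} {τ} s (v∉τ , f) =
    (λ v∈σ → v∉τ (s v∈σ)) ,
    downClosed K (λ {x} x∈ → mono x∈) f
    where
    mono : ∀ {x} → x ∈ σ ∪ ⁅ v ⁆ → x ∈ τ ∪ ⁅ v ⁆
    mono {x} x∈ with x∈p∪q⁻ σ ⁅ v ⁆ x∈
    ... | inj₁ a = p⊆p∪q ⁅ v ⁆ (s a)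
    ... | inj₂ b = q⊆p∪q τ ⁅ v ⁆ b

deletion : ∀ {n} → Complex n → Fin n → Complex n
deletion K v = record
  { face = λ τ → (v ∉ τ) × face K τ
  ; downClosed = λ s p → (λ v∈σ → proj₁ p (s v∈σ)) , downClosed K s (proj₂ p) }
  where open import Data.Product using (_,_; proj₁; proj₂)

IsPoint : ∀ {n} → Complex n → Set
IsPoint {n} K = ∃ λ (v : Fin n) → ∀ σ → (face K σ → σ ⊆ ⁅ v ⁆) × (σ ⊆ ⁅ v ⁆ → face K σ)

data Nonevasive {n : ℕ} : Complex n → Set₁ where
  point : ∀ {K} → IsPoint K → Nonevasive K
  step  : ∀ {K} (v : Fin n) → IsVertex K v →
          Nonevasive (link K v) → Nonevasive (deletion K v) → Nonevasive K

Edge : ∀ {n} → Complex n → Fin n → Fin n → Set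
Edge K x y = (x ≢ y) × face K (⁅ x ⁆ ∪ ⁅ y ⁆)

data Path {n} (K : Complex n) : Fin n → Fin n → Set where
  here  : ∀ {x} → Path K x x
  there : ∀ {x y z} → Edge K x y → Path K y z → Path K x z

Cycle : ∀ {n} → Complex n → Fin n → List (Fin n) → Set
Cycle K x xs = (2 ≤ length xs) × Unique (x ∷ xs) × Linked (Edge K) (x ∷ xs ++ x ∷ [])

IsTree : ∀ {n} → Complex n → Set
IsTree {n} K =
  (∀ σ → face K σ → ∣ σ ∣ ≤ 2) ×
  (∃ λ x → IsVertex K x) ×
  (∀ x y → IsVertex K x → IsVertex K y → Path K x y) ×
  (∀ x xs → ¬ Cycle K x xs)

IsSingleEdge : ∀ {n} → Complex n → Set
IsSingleEdge {n} K = Σ (Fin n) λ a → Σ (Fin n) λ b → (a ≢ b) ×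
  (∀ σ → (face K σ → σ ⊆ ⁅ a ⁆ ∪ ⁅ b ⁆) × (σ ⊆ ⁅ a ⁆ ∪ ⁅ b ⁆ → face K σ))

-- Let lk_K(v) be the edge {a, b} and unfold the nonevasiveness of K once.
-- If the first vertex removed is some u ≠ v, its link is a nonevasive graph.
-- Otherwise K ∖ v is nonevasive; it is not a point (it contains a and b), so
-- some vertex w has a nonevasive link lk_{K∖v}(w) = lk_K(w) ∖ v. For w ∉ {a, b}
-- the vertex v is not in lk_K(w), so this is lk_K(w) itself; for w = a, the
-- link of v in lk_K(a) is lk(lk_K(v), a) = {b}, a point, so lk_K(a) is
-- nonevasive by removing v first. Finally a nonevasive graph is a tree: the
-- vertex removed first has a point as link, i.e. it is a leaf, and adding a
-- leaf to a tree gives a tree.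
module Submission where

open import Defs
open import Data.Nat using (ℕ; suc; _≤_; s≤s)
open import Data.Nat.Properties using (≤-trans; ≤-pred)
open import Data.Fin using (Fin; _≟_)
open import Data.Fin.Subset using (Subset; _∈_; _∉_; _⊆_; ⁅_⁆; _∪_; ∣_∣)
open import Data.Fin.Subset.Properties
  using (x∈⁅x⁆; x∈⁅y⁆⇒x≡y; x≢y⇒x∉⁅y⁆; x∉⁅y⁆⇒x≢y; ∣⁅x⁆∣≡1; p⊂q⇒∣p∣<∣q∣; x∈p∪q⁻; p⊆p∪q; q⊆p∪q; ∪-assoc; ∪-comm)
open import Data.List using (List; []; _∷_; _++_; length)
open import Data.List.Membership.Propositional using () renaming (_∈_ to _∈ₗ_)
open import Data.List.Relation.Unary.All using (All; []; _∷_) renaming (lookup to All-lookup)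
open import Data.List.Relation.Unary.All.Properties using (¬Any⇒All¬) renaming (++⁺ to All-++⁺)
open import Data.List.Relation.Unary.Any using (here; there; any?)
open import Data.List.Relation.Unary.AllPairs using (_∷_)
open import Data.List.Relation.Unary.Linked using (Linked; []; [-]; _∷_)
open import Data.List.Relation.Unary.Unique.Propositional using (Unique)
open import Data.Product using (∃; _×_; _,_; proj₁; proj₂; map₂)
open import Data.Sum using (_⊎_; inj₁; inj₂; [_,_])
open import Data.Empty using (⊥-elim)
open import Function using (_∘_)
open import Function.Bundles using (_⇔_; mk⇔; Equivalence)
open import Relation.Nullary using (¬_; yes; no)
open import Relation.Binary.PropositionalEquality
  using (_≡_; _≢_; refl; sym; trans; subst; cong; ≢-sym; module ≡-Reasoning)

private variable
  n : ℕ

open Equivalence using (to; from)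

∉⁅⁆-sym : {x y : Fin n} → x ∉ ⁅ y ⁆ → y ∉ ⁅ x ⁆
∉⁅⁆-sym = x≢y⇒x∉⁅y⁆ ∘ ≢-sym ∘ x∉⁅y⁆⇒x≢y

x∈p⇒⁅x⁆⊆p : {x : Fin n} {p : Subset n} → x ∈ p → ⁅ x ⁆ ⊆ p
x∈p⇒⁅x⁆⊆p {x = x} x∈p y∈⁅x⁆ with x∈⁅y⁆⇒x≡y x y∈⁅x⁆
... | refl = x∈p

∪-least : {p q r : Subset n} → p ⊆ r → q ⊆ r → p ∪ q ⊆ r
∪-least {p = p} {q} p⊆r q⊆r = [ p⊆r , q⊆r ] ∘ x∈p∪q⁻ p q

∉-∪⁺ : {x : Fin n} {p q : Subset n} → x ∉ p → x ∉ q → x ∉ p ∪ q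
∉-∪⁺ {p = p} {q} x∉p x∉q = [ x∉p , x∉q ] ∘ x∈p∪q⁻ p q

∉-∪⁻ : {x : Fin n} {p q : Subset n} → x ∉ p ∪ q → x ∉ p × x ∉ q
∉-∪⁻ {q = q} x∉p∪q = x∉p∪q ∘ p⊆p∪q q , x∉p∪q ∘ q⊆p∪q _ q

∪-swapʳ : (p q r : Subset n) → (p ∪ q) ∪ r ≡ (p ∪ r) ∪ q
∪-swapʳ p q r = begin
  (p ∪ q) ∪ r  ≡⟨ ∪-assoc p q r ⟩
  p ∪ (q ∪ r)  ≡⟨ cong (p ∪_) (∪-comm q r) ⟩
  p ∪ (r ∪ q)  ≡⟨ ∪-assoc p r q ⟨
  (p ∪ r) ∪ q  ∎
  where open ≡-Reasoning

IsFullSimplex : Complex n → Subset n → Set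
IsFullSimplex K S = ∀ σ → (face K σ → σ ⊆ S) × (σ ⊆ S → face K σ)

full-simplex-vertex⁻ : {K : Complex n} {S : Subset n} {x : Fin n} →
                       IsFullSimplex K S → IsVertex K x → x ∈ S
full-simplex-vertex⁻ {x = x} K=S x∈K = proj₁ (K=S ⁅ x ⁆) x∈K (x∈⁅x⁆ x)

full-simplex-vertex⁺ : {K : Complex n} {S : Subset n} {x : Fin n} →
                       IsFullSimplex K S → x ∈ S → IsVertex K x
full-simplex-vertex⁺ {x = x} K=S x∈S = proj₂ (K=S ⁅ x ⁆) (x∈p⇒⁅x⁆⊆p x∈S)

link-apex : {K : Complex n} {T : Subset n} {a : Fin n} →
            a ∉ T → IsFullSimplex K (T ∪ ⁅ a ⁆) → IsFullSimplex (link K a) T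
link-apex {K = K} {T} {a} a∉T K=Ta σ = ⊆T , ⊆T⇒face
  where
  ⊆T : face (link K a) σ → σ ⊆ T
  ⊆T (a∉σ , f) {x} x∈σ with x∈p∪q⁻ T ⁅ a ⁆ (proj₁ (K=Ta _) f (p⊆p∪q ⁅ a ⁆ x∈σ))
  ... | inj₁ x∈T = x∈T
  ... | inj₂ x∈⁅a⁆ rewrite x∈⁅y⁆⇒x≡y a x∈⁅a⁆ = ⊥-elim (a∉σ x∈σ)
  ⊆T⇒face : σ ⊆ T → face (link K a) σ
  ⊆T⇒face σ⊆T = a∉T ∘ σ⊆T , proj₂ (K=Ta _) (∪-least (p⊆p∪q ⁅ a ⁆ ∘ σ⊆T) (q⊆p∪q T ⁅ a ⁆))

point-vertex : {K : Complex n} → IsPoint K → ∃ (IsVertex K)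
point-vertex {K = K} (p , K=p) = p , full-simplex-vertex⁺ {K = K} K=p (x∈⁅x⁆ p)

point-vertex-unique : {K : Complex n} {x y : Fin n} → IsPoint K → IsVertex K x → IsVertex K y → x ≡ y
point-vertex-unique {K = K} (p , K=p) x∈K y∈K =
  trans (x∈⁅y⁆⇒x≡y p (full-simplex-vertex⁻ {K = K} K=p x∈K))
        (sym (x∈⁅y⁆⇒x≡y p (full-simplex-vertex⁻ {K = K} K=p y∈K)))

edge-sym : {K : Complex n} {x y : Fin n} → Edge K x y → Edge K y x
edge-sym {K = K} {x} {y} (x≢y , f) = ≢-sym x≢y , subst (face K) (∪-comm ⁅ x ⁆ ⁅ y ⁆) f

point-no-edge : {K : Complex n} {x y : Fin n} → IsPoint K → ¬ Edge K x y
point-no-edge {K = K} {x} {y} pt (x≢y , f) =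
  x≢y (point-vertex-unique {K = K} pt (downClosed K (p⊆p∪q ⁅ y ⁆) f) (downClosed K (q⊆p∪q ⁅ x ⁆ ⁅ y ⁆) f))

link-vertex⇒edge : {K : Complex n} {u w : Fin n} → IsVertex (link K u) w → Edge K w u
link-vertex⇒edge (u∉⁅w⁆ , f) = ≢-sym (x∉⁅y⁆⇒x≢y u∉⁅w⁆) , f

edge⇒link-vertex : {K : Complex n} {u w : Fin n} → Edge K w u → IsVertex (link K u) w
edge⇒link-vertex (w≢u , f) = x≢y⇒x∉⁅y⁆ (≢-sym w≢u) , f

link-vertex-sym : {K : Complex n} {u w : Fin n} → IsVertex (link K u) w → IsVertex (link K w) u
link-vertex-sym {K = K} = edge⇒link-vertex {K = K} ∘ edge-sym {K = K} ∘ link-vertex⇒edge {K = K}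

deletion-vertex⁺ : {K : Complex n} {v w : Fin n} → w ≢ v → IsVertex K w → IsVertex (deletion K v) w
deletion-vertex⁺ w≢v w∈K = x≢y⇒x∉⁅y⁆ (≢-sym w≢v) , w∈K

deletion-vertex⁻ : {K : Complex n} {v w : Fin n} → IsVertex (deletion K v) w → w ≢ v × IsVertex K w
deletion-vertex⁻ (v∉⁅w⁆ , w∈K) = ≢-sym (x∉⁅y⁆⇒x≢y v∉⁅w⁆) , w∈K

link-vertex⇒deletion-vertex : {K : Complex n} {v w : Fin n} → IsVertex (link K v) w → IsVertex (deletion K v) w
link-vertex⇒deletion-vertex {K = K} {v} {w} w∈lkv@(_ , f) =
  deletion-vertex⁺ {K = K} (proj₁ (link-vertex⇒edge {K = K} w∈lkv)) (downClosed K (p⊆p∪q ⁅ v ⁆) f)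

nonevasive-vertex : {K : Complex n} → Nonevasive K → ∃ (IsVertex K)
nonevasive-vertex {K = K} (point pt) = point-vertex {K = K} pt
nonevasive-vertex (step v v∈K _ _) = v , v∈K

infix 4 _≅_
_≅_ : Complex n → Complex n → Set
K ≅ L = ∀ σ → face K σ ⇔ face L σ

link-resp-≅ : {K L : Complex n} {v : Fin n} → K ≅ L → link K v ≅ link L v
link-resp-≅ {K = K} {L} {v} K≅L σ = mk⇔ (map₂ (to (K≅L (σ ∪ ⁅ v ⁆)))) (map₂ (from (K≅L (σ ∪ ⁅ v ⁆))))

deletion-resp-≅ : {K L : Complex n} {v : Fin n} → K ≅ L → deletion K v ≅ deletion L v
deletion-resp-≅ K≅L σ = mk⇔ (map₂ (to (K≅L σ))) (map₂ (from (K≅L σ)))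

point-resp-≅ : {K L : Complex n} → K ≅ L → IsPoint K → IsPoint L
point-resp-≅ {K = K} {L} K≅L (p , K=p) = p , λ σ → proj₁ (K=p σ) ∘ from (K≅L σ) , to (K≅L σ) ∘ proj₂ (K=p σ)

nonevasive-resp-≅ : {K L : Complex n} → K ≅ L → Nonevasive K → Nonevasive L
nonevasive-resp-≅ {K = K} {L} K≅L (point pt) = point (point-resp-≅ {K = K} {L} K≅L pt)
nonevasive-resp-≅ {K = K} {L} K≅L (step v v∈K NL ND) =
  step v (to (K≅L ⁅ v ⁆) v∈K)
    (nonevasive-resp-≅ (link-resp-≅ {K = K} {L} K≅L) NL)
    (nonevasive-resp-≅ (deletion-resp-≅ {K = K} {L} K≅L) ND)

link-comm : (K : Complex n) (u v : Fin n) → link (link K u) v ≅ link (link K v) u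
link-comm K u v σ = mk⇔ (swap u v) (swap v u)
  where
  swap : ∀ s t → face (link (link K s) t) σ → face (link (link K t) s) σ
  swap s t (t∉σ , s∉σ∪t , f) =
    proj₁ (∉-∪⁻ s∉σ∪t) , ∉-∪⁺ t∉σ (∉⁅⁆-sym (proj₂ (∉-∪⁻ s∉σ∪t))) , subst (face K) (∪-swapʳ σ ⁅ t ⁆ ⁅ s ⁆) f

link-deletion-comm : {K : Complex n} {u v : Fin n} → u ≢ v → link (deletion K v) u ≅ deletion (link K u) v
link-deletion-comm u≢v σ = mk⇔
  (λ (u∉σ , v∉σ∪u , f) → proj₁ (∉-∪⁻ v∉σ∪u) , u∉σ , f)
  (λ (v∉σ , u∉σ , f) → u∉σ , ∉-∪⁺ v∉σ (x≢y⇒x∉⁅y⁆ (≢-sym u≢v)) , f)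

deletion-of-nonvertex : {L : Complex n} {v : Fin n} → ¬ IsVertex L v → deletion L v ≅ L
deletion-of-nonvertex {L = L} v∉L σ = mk⇔ proj₂ (λ f → (λ v∈σ → v∉L (downClosed L (x∈p⇒⁅x⁆⊆p v∈σ) f)) , f)

FaceSize≤ : ℕ → Complex n → Set
FaceSize≤ m K = ∀ σ → face K σ → ∣ σ ∣ ≤ m

link-faceSize : {K : Complex n} {u : Fin n} {m : ℕ} → FaceSize≤ (suc m) K → FaceSize≤ m (link K u)
link-faceSize {u = u} K≤ σ (u∉σ , f) =
  ≤-pred (≤-trans (p⊂q⇒∣p∣<∣q∣ (p⊆p∪q ⁅ u ⁆ , u , q⊆p∪q σ ⁅ u ⁆ (x∈⁅x⁆ u) , u∉σ)) (K≤ _ f))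

faceSize≤0-no-vertex : {K : Complex n} {x : Fin n} → FaceSize≤ 0 K → ¬ IsVertex K x
faceSize≤0-no-vertex {x = x} K≤ x∈K with subst (_≤ 0) (∣⁅x⁆∣≡1 x) (K≤ ⁅ x ⁆ x∈K)
... | ()

nonevasive-faceSize≤1⇒single-vertex : {L : Complex n} → FaceSize≤ 1 L → Nonevasive L →
  ∃ λ y → IsVertex L y × (∀ z → IsVertex L z → z ≡ y)
nonevasive-faceSize≤1⇒single-vertex {L = L} L≤ (point pt) =
  let y , y∈L = point-vertex {K = L} pt in
  y , y∈L , λ z z∈L → point-vertex-unique {K = L} pt z∈L y∈L
nonevasive-faceSize≤1⇒single-vertex {L = L} L≤ (step y _ NL _) =
  ⊥-elim (faceSize≤0-no-vertex {K = link L y} (link-faceSize {K = L} L≤) (proj₂ (nonevasive-vertex NL)))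

path-trans : {K : Complex n} {x y z : Fin n} → Path K x y → Path K y z → Path K x z
path-trans here q = q
path-trans (there e p) q = there e (path-trans p q)

path-sym : {K : Complex n} {x y : Fin n} → Path K x y → Path K y x
path-sym here = here
path-sym {K = K} (there e p) = path-trans (path-sym p) (there (edge-sym {K = K} e) here)

deletion-path⇒path : {K : Complex n} {v x y : Fin n} → Path (deletion K v) x y → Path K x y
deletion-path⇒path here = here
deletion-path⇒path (there (x≢y , _ , f) p) = there (x≢y , f) (deletion-path⇒path p)

point⇒tree : {G : Complex n} → FaceSize≤ 2 G → IsPoint G → IsTree G
point⇒tree {G = G} G≤ pt = G≤ , point-vertex {K = G} pt , connected , acyclic
  where
  connected : ∀ x y → IsVertex G x → IsVertex G y → Path G x y
  connected x y x∈G y∈G = subst (Path G x) (point-vertex-unique {K = G} pt x∈G y∈G) here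
  acyclic : ∀ x xs → ¬ Cycle G x xs
  acyclic x (_ ∷ _) (_ , _ , e ∷ _) = point-no-edge {K = G} pt e

deletion-walk : {G : Complex n} {v : Fin n} {ws : List (Fin n)} →
                All (v ≢_) ws → Linked (Edge G) ws → Linked (Edge (deletion G v)) ws
deletion-walk _ [] = []
deletion-walk _ [-] = [-]
deletion-walk {G = G} (v≢a ∷ v≢b ∷ v≢ws) ((a≢b , f) ∷ lk) =
  (a≢b , ∉-∪⁺ (x≢y⇒x∉⁅y⁆ v≢a) (x≢y⇒x∉⁅y⁆ v≢b) , f) ∷ deletion-walk {G = G} (v≢b ∷ v≢ws) lk

module _ {A : Set} {E : A → A → Set} (E-sym : ∀ {a b} → E a b → E b a)
         {x y : A} (leaf : ∀ {z} → E x z → z ≡ y) where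

  private
    last-edge : ∀ c zs → Linked E (c ∷ zs ++ x ∷ []) → ∃ λ l → l ∈ₗ c ∷ zs × E l x
    last-edge c [] (e ∷ [-]) = c , here refl , e
    last-edge c (z ∷ zs) (_ ∷ lk) = let l , l∈ , e = last-edge z zs lk in l , there l∈ , e

    neighbours-equal : ∀ {a b} → E a x → E x b → a ≡ b
    neighbours-equal e₁ e₂ = trans (leaf (E-sym e₁)) (sym (leaf e₂))

  leaf-not-cycle-base : ∀ xs → 2 ≤ length xs → Unique xs → ¬ Linked E (x ∷ xs ++ x ∷ [])
  leaf-not-cycle-base (_ ∷ []) (s≤s ()) _ _
  leaf-not-cycle-base (c ∷ d ∷ zs) _ (c∉ ∷ _) (e ∷ _ ∷ lk) =
    let l , l∈ , e′ = last-edge d zs lk in All-lookup c∉ l∈ (neighbours-equal (E-sym e) (E-sym e′))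

  -- The last hypothesis says that the two neighbours of x on the walk differ.
  leaf-not-walk-interior : ∀ p zs q → Linked E (p ∷ zs ++ q ∷ []) → Unique (p ∷ zs) →
                           All (q ≢_) zs → p ≢ q ⊎ 2 ≤ length zs → ¬ x ∈ₗ zs
  leaf-not-walk-interior p (_ ∷ []) q (e₁ ∷ e₂ ∷ [-]) _ _ (inj₁ p≢q) (here refl) =
    p≢q (neighbours-equal e₁ e₂)
  leaf-not-walk-interior p (_ ∷ []) q _ _ _ (inj₂ (s≤s ())) (here refl)
  leaf-not-walk-interior p (_ ∷ r ∷ zs) q (e₁ ∷ e₂ ∷ _) ((_ ∷ p≢r ∷ _) ∷ _) _ _ (here refl) =
    p≢r (neighbours-equal e₁ e₂)
  leaf-not-walk-interior p (z ∷ zs) q (_ ∷ lk) (_ ∷ u) (q≢z ∷ q∉zs) _ (there x∈zs) =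
    leaf-not-walk-interior z zs q lk u q∉zs (inj₁ (≢-sym q≢z)) x∈zs

  leaf-not-on-cycle : ∀ x₀ xs → 2 ≤ length xs → Unique (x₀ ∷ xs) → Linked E (x₀ ∷ xs ++ x₀ ∷ []) →
                      ¬ x ∈ₗ x₀ ∷ xs
  leaf-not-on-cycle x₀ xs len (_ ∷ u) lk (here refl) = leaf-not-cycle-base xs len u lk
  leaf-not-on-cycle x₀ xs len u@(x₀∉xs ∷ _) lk (there x∈xs) =
    leaf-not-walk-interior x₀ xs x₀ lk u x₀∉xs (inj₂ len) x∈xs

leaf-extension : {G : Complex n} {x y : Fin n} → FaceSize≤ 2 G → IsVertex G x →
                 IsVertex (link G x) y → (∀ z → IsVertex (link G x) z → z ≡ y) →
                 IsTree (deletion G x) → IsTree G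
leaf-extension {G = G} {x} {y} G≤ x∈G y∈lk lk=y (_ , _ , tree-connected , tree-acyclic) =
  G≤ , (x , x∈G) , connected , acyclic
  where
  leaf : ∀ {z} → Edge G x z → z ≡ y
  leaf = lk=y _ ∘ edge⇒link-vertex {K = G} ∘ edge-sym {K = G}

  reach-y : ∀ a → IsVertex G a → Path G a y
  reach-y a a∈G with a ≟ x
  ... | yes refl = there (edge-sym {K = G} (link-vertex⇒edge {K = G} y∈lk)) here
  ... | no a≢x = deletion-path⇒path
    (tree-connected a y (deletion-vertex⁺ {K = G} a≢x a∈G) (link-vertex⇒deletion-vertex {K = G} y∈lk))

  connected : ∀ a b → IsVertex G a → IsVertex G b → Path G a b
  connected a b a∈G b∈G = path-trans (reach-y a a∈G) (path-sym {K = G} (reach-y b b∈G))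

  acyclic : ∀ x₀ xs → ¬ Cycle G x₀ xs
  acyclic x₀ xs (len , u , lk) with any? (x ≟_) (x₀ ∷ xs)
  ... | yes x∈cycle = leaf-not-on-cycle (edge-sym {K = G}) leaf x₀ xs len u lk x∈cycle
  ... | no x∉cycle with ¬Any⇒All¬ (x₀ ∷ xs) x∉cycle
  ...   | x≢x₀ ∷ x∉xs =
    tree-acyclic x₀ xs (len , u , deletion-walk {G = G} (x≢x₀ ∷ All-++⁺ x∉xs (x≢x₀ ∷ [])) lk)

nonevasive-graph⇒tree : {G : Complex n} → FaceSize≤ 2 G → Nonevasive G → IsTree G
nonevasive-graph⇒tree {G = G} G≤ (point pt) = point⇒tree {G = G} G≤ pt
nonevasive-graph⇒tree {G = G} G≤ (step x x∈G NL ND) =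
  let y , y∈lk , lk=y = nonevasive-faceSize≤1⇒single-vertex (link-faceSize {K = G} G≤) NL in
  leaf-extension {G = G} G≤ x∈G y∈lk lk=y (nonevasive-graph⇒tree (λ σ → G≤ σ ∘ proj₂) ND)

edge-simplex-vertices : {L : Complex n} {a b : Fin n} → IsFullSimplex L (⁅ a ⁆ ∪ ⁅ b ⁆) →
                        IsVertex L a × IsVertex L b
edge-simplex-vertices {L = L} {a} {b} L=ab =
  full-simplex-vertex⁺ {K = L} L=ab (p⊆p∪q ⁅ b ⁆ (x∈⁅x⁆ a)) ,
  full-simplex-vertex⁺ {K = L} L=ab (q⊆p∪q ⁅ a ⁆ ⁅ b ⁆ (x∈⁅x⁆ b))

edge-end-link-nonevasive : {K : Complex n} {v b c : Fin n} → b ≢ c →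
  IsFullSimplex (link K v) (⁅ b ⁆ ∪ ⁅ c ⁆) → Nonevasive (link (deletion K v) c) → Nonevasive (link K c)
edge-end-link-nonevasive {K = K} {v} {b} {c} b≢c lkv=bc NL =
  step v (link-vertex-sym {K = K} c∈lkv)
    (nonevasive-resp-≅ {K = link (link K v) c} (link-comm K v c) (point (b , lkvc=b)))
    (nonevasive-resp-≅ (link-deletion-comm {K = K} (proj₁ (link-vertex⇒edge {K = K} c∈lkv))) NL)
  where
  lkvc=b : IsFullSimplex (link (link K v) c) ⁅ b ⁆
  lkvc=b = link-apex {K = link K v} (x≢y⇒x∉⁅y⁆ (≢-sym b≢c)) lkv=bc
  c∈lkv : IsVertex (link K v) c
  c∈lkv = proj₂ (edge-simplex-vertices {L = link K v} lkv=bc)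

link-nonevasive-from-deletion : {K : Complex n} {v a b u : Fin n} → a ≢ b →
  IsFullSimplex (link K v) (⁅ a ⁆ ∪ ⁅ b ⁆) → u ≢ v → Nonevasive (link (deletion K v) u) → Nonevasive (link K u)
link-nonevasive-from-deletion {K = K} {v} {a} {b} {u} a≢b lkv=ab u≢v NL with u ≟ a | u ≟ b
... | yes refl | _ =
  edge-end-link-nonevasive {K = K} (≢-sym a≢b) (subst (IsFullSimplex (link K v)) (∪-comm ⁅ a ⁆ ⁅ b ⁆) lkv=ab) NL
... | _ | yes refl = edge-end-link-nonevasive {K = K} a≢b lkv=ab NL
... | no u≢a | no u≢b =
  nonevasive-resp-≅ {K = deletion (link K u) v} (deletion-of-nonvertex {L = link K u} v∉lku)
    (nonevasive-resp-≅ {K = link (deletion K v) u} (link-deletion-comm {K = K} u≢v) NL)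
  where
  v∉lku : ¬ IsVertex (link K u) v
  v∉lku v∈lku = [ u≢a ∘ x∈⁅y⁆⇒x≡y a , u≢b ∘ x∈⁅y⁆⇒x≡y b ]
    (x∈p∪q⁻ ⁅ a ⁆ ⁅ b ⁆ (full-simplex-vertex⁻ {K = link K v} lkv=ab (link-vertex-sym {K = K} v∈lku)))

fact3p2 : (n : ℕ) (K : Complex n) → Dim≤2 K → Nonevasive K →
    (v : Fin n) → IsSingleEdge (link K v) →
    ∃ λ (w : Fin n) → (w ≢ v) × IsVertex K w × IsTree (link K w)
fact3p2 n K dim (point pt) v (_ , _ , _ , lkv=ab) =
  ⊥-elim (point-no-edge {K = K} pt (link-vertex⇒edge {K = K} (proj₁ (edge-simplex-vertices {L = link K v} lkv=ab))))
fact3p2 n K dim (step u u∈K NL ND) v (a , b , a≢b , lkv=ab) with u ≟ v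
... | no u≢v = u , u≢v , u∈K , nonevasive-graph⇒tree (link-faceSize {K = K} dim) NL
... | yes refl with ND
...   | point pt =
  let a∈lkv , b∈lkv = edge-simplex-vertices {L = link K v} lkv=ab in
  ⊥-elim (a≢b (point-vertex-unique {K = deletion K v} pt
    (link-vertex⇒deletion-vertex {K = K} a∈lkv) (link-vertex⇒deletion-vertex {K = K} b∈lkv)))
...   | step w w∈K∖v NLw _ =
  let w≢v , w∈K = deletion-vertex⁻ {K = K} w∈K∖v in
  w , w≢v , w∈K , nonevasive-graph⇒tree (link-faceSize {K = K} dim)
                    (link-nonevasive-from-deletion {K = K} a≢b lkv=ab w≢v NLw)
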